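{- State reachability is decidable in $\mu$Stipula$^{\tt DI}_{+}$: there is an algorithm that, given a $\mu$Stipula$^{\tt DI}$ contract ${\tt C}$ and a state ${\tt Q}$, decides whether there is $\Psi$ with ${\tt C}({\tt Q}_{\rm init},\_,\_)\to_{\tt tp}^*{\tt C}({\tt Q},\_,\Psi)$.
   Context: A $\mu$Stipula contract ${\tt C}$ consists of a finite set of states, an initial state ${\tt Q}_{\rm init}$, and a finite set of functions $@{\tt Q}\; {\tt f}\,\{W\} \Rightarrow @{\tt Q}'$, where $W$ is a finite sequence of events ${\tt now}+k \gg @{\tt Q}_1 \Rightarrow @{\tt Q}_2$ (${\tt Q}_1$ is the event's initial state), each event occurrence carrying a unique line index $n$. A pending event is $k \gg_n {\tt Q}_1 \Rightarrow {\tt Q}_2$. A configuration is ${\tt C}({\tt Q},\Sigma,\Psi)$ with ${\tt Q}$ a state, $\Psi$ a finite multiset of pending events (written with $|$, empty $\_$), and $\Sigma$ either empty ($\_$) or $\Psi'\Rightarrow{\tt Q}'$. $\mathit{nored}(\Psi,{\tt Q})$ holds iff $\Psi$ has no pending event $0\gg_n {\tt Q}\Rightarrow {\tt Q}'$; $\Psi\!\downarrow$ deletes pending events with time $0$ and decrements all others. Let $\mathtt{InitEv}({\tt C})$ be the set of initial states of events in ${\tt C}$. The relation $\to_{\tt tp}$ (semantics of $\mu$Stipula$^{\tt DI}_{+}$) is: (Function) if $@{\tt Q}\,{\tt f}\{W\}\Rightarrow@{\tt Q}'$ is in ${\tt C}$ and $\mathit{nored}(\Psi,{\tt Q})$, then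 ${\tt C}({\tt Q},\_,\Psi)\to_{\tt tp}{\tt C}({\tt Q},\Psi_W\Rightarrow{\tt Q}',\Psi)$, with $\Psi_W$ the multiset of $k\gg_n{\tt Q}_1\Rightarrow{\tt Q}_2$ for the events of $W$; (State-Change) ${\tt C}({\tt Q},\Psi'\Rightarrow{\tt Q}',\Psi)\to_{\tt tp}{\tt C}({\tt Q}',\_,\Psi'|\Psi)$; (Event-Match) ${\tt C}({\tt Q},\_,0\gg_n{\tt Q}\Rightarrow{\tt Q}'\,|\,\Psi')\to_{\tt tp}{\tt C}({\tt Q},\_\Rightarrow{\tt Q}',\Psi')$; (Tick-Plus) if ${\tt Q}\notin\mathtt{InitEv}({\tt C})$ then ${\tt C}({\tt Q},\_,\Psi)\to_{\tt tp}{\tt C}({\tt Q},\_,\Psi\!\downarrow)$. $\mu$Stipula$^{\tt DI}$ (syntactically identical to $\mu$Stipula$^{\tt DI}_{+}$) is the fragment of contracts in which every event has time expression ${\tt now}+0$ and no state is both the initial state of a function and the initial state of an event. -}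

module Defs where

open import Data.Nat using (ℕ; zero; suc)
open import Data.Fin using (Fin)
open import Data.List using (List; []; _∷_; _++_; concatMap; map)
open import Data.List.Relation.Unary.All using (All)
open import Data.List.Relation.Unary.Any using (Any)
open import Data.List.Relation.Unary.Unique.Propositional using (Unique)
open import Data.List.Membership.Propositional using (_∈_)
open import Data.Maybe using (Maybe; just; nothing)
open import Data.Product using (_×_; ∃)
open import Relation.Binary.PropositionalEquality using (_≡_)
open import Relation.Nullary using (¬_)
open import Relation.Binary.Construct.Closure.ReflexiveTransitive using (Star)

-- An event  now + time ≫ @from ⇒ @to  with line index `line`.
-- A pending event  time ≫_line from ⇒ to  has the same shape.
record Event (n : ℕ) : Set where
  constructor ev
  field
    time : ℕ
    line : ℕ
    from : Fin n
    to   : Fin n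
open Event public

record Function (n : ℕ) : Set where
  constructor fn
  field
    src    : Fin n
    name   : ℕ
    events : List (Event n)
    tgt    : Fin n
open Function public

record Contract (n : ℕ) : Set where
  constructor contract
  field
    init      : Fin n
    functions : List (Function n)
open Contract public

allEvents : ∀ {n} → Contract n → List (Event n)
allEvents C = concatMap events (functions C)

WellFormed : ∀ {n} → Contract n → Set
WellFormed C = Unique (map line (allEvents C))

InitEv : ∀ {n} → Contract n → Fin n → Set
InitEv C Q = Any (λ e → from e ≡ Q) (allEvents C)

InitFun : ∀ {n} → Contract n → Fin n → Set
InitFun C Q = Any (λ f → src f ≡ Q) (functions C)

IsDI : ∀ {n} → Contract n → Set
IsDI C = All (λ e → time e ≡ 0) (allEvents C)
       × (∀ Q → InitFun C Q → ¬ InitEv C Q)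

-- multisets of pending events are represented by lists (all rules are
-- invariant under permutation; Event-Match may pick any element)
Pending : ℕ → Set
Pending n = List (Event n)

nored : ∀ {n} → Pending n → Fin n → Set
nored Ψ Q = ¬ Any (λ e → time e ≡ 0 × from e ≡ Q) Ψ

tick : ∀ {n} → Pending n → Pending n
tick [] = []
tick (ev zero l a b ∷ Ψ) = tick Ψ
tick (ev (suc k) l a b ∷ Ψ) = ev k l a b ∷ tick Ψ

record Config (n : ℕ) : Set where
  constructor cfg
  field
    state : Fin n
    sigma : Maybe (Pending n × Fin n)   -- nothing = _, just (Ψ' , Q') = Ψ' ⇒ Q'
    psi   : Pending n

data Step {n} (C : Contract n) : Config n → Config n → Set where
  function : ∀ {f Ψ} → f ∈ functions C → nored Ψ (src f) →
    Step C (cfg (src f) nothing Ψ) (cfg (src f) (just (events f Data.Product., tgt f)) Ψ)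
  state-change : ∀ {Q Ψ' Q' Ψ} →
    Step C (cfg Q (just (Ψ' Data.Product., Q')) Ψ) (cfg Q' nothing (Ψ' ++ Ψ))
  event-match : ∀ {Q Q' k l Ψ₁ Ψ₂} → k ≡ 0 →
    Step C (cfg Q nothing (Ψ₁ ++ ev k l Q Q' ∷ Ψ₂)) (cfg Q (just ([] Data.Product., Q')) (Ψ₁ ++ Ψ₂))
  tick-plus : ∀ {Q Ψ} → ¬ InitEv C Q →
    Step C (cfg Q nothing Ψ) (cfg Q nothing (tick Ψ))

_⟶*_ : ∀ {n} {C : Contract n} → Config n → Config n → Set
_⟶*_ {C = C} = Star (Step C)

initConfig : ∀ {n} → Contract n → Config n
initConfig C = cfg (init C) nothing []

StateReachable : ∀ {n} → Contract n → Fin n → Set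
StateReachable C Q = ∃ λ Ψ → Star (Step C) (initConfig C) (cfg Q nothing Ψ)

{-# OPTIONS --safe #-}
-- In a DI contract every event fires at time 0 and no function starts in a state where an
-- event is triggered, so pending events never block a function and Tick-Plus just empties
-- the pending multiset. Fusing each Function or Event-Match step with the State-Change after
-- it yields a transition system on markings (state, multiset of pending events) that is
-- monotone for the order "same state, pointwise fewer events". Reachability of Q thus becomes
-- coverability: the markings from which Q is reachable form an upward-closed set, whose
-- finite basis is computed by backward saturation, adding uncovered minimal predecessors
-- until none is left. Saturation terminates because the order is almost full (Dickson's
-- lemma, proved constructively through the intersection theorem for almost-full relations).
module Submission where

open import Defs
open import Data.Nat using (ℕ)
open import Data.Fin using (Fin)
open import Relation.Nullary using (Dec)

open import Level using (0ℓ)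
open import Data.Nat using (zero; suc; _+_; _∸_; _≤_; _<_; _≤?_; z≤n; s≤s)
open import Data.Nat.Properties
  using ( ≤-refl; ≤-trans; ≤-antisym; ≤-pred; ≰⇒>; <-≤-trans; m≤n+m; +-assoc; +-monoʳ-≤
        ; +-cancelˡ-≤; m+n∸m≡n; 0∸n≡0; ∸-+-assoc; ∸-monoʳ-≤; ∸-cancelˡ-≡; m≤n+m∸n; m≤n+o⇒m∸n≤o)
import Data.Nat.Properties as ℕ
open import Algebra.Properties.CommutativeSemigroup ℕ.+-commutativeSemigroup using (x∙yz≈y∙xz)
open import Data.Fin using (toℕ)
open import Data.Fin.Properties using (toℕ-injective; toℕ≤n)
import Data.Fin.Properties as Fin
open import Data.Product using (_×_; _,_; proj₁; proj₂; swap; ∃-syntax)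
import Data.Product as Product
open import Data.Product.Properties using (≡-dec)
open import Data.Sum using (_⊎_; inj₁; inj₂; fromInj₁)
import Data.Sum as Sum
open import Data.Empty using (⊥-elim)
open import Data.Maybe using (just; nothing)
open import Data.List using (List; []; _∷_; _++_; [_]; map; filter)
open import Data.List.Relation.Unary.All as All using (All; []; _∷_; all?)
open import Data.List.Relation.Unary.All.Properties using (¬All⇒Any¬; ++⁺; ++⁻)
open import Data.List.Relation.Unary.Any as Any using (Any; here; there; any?)
open import Data.List.Membership.Propositional using (_∈_; find; lose)
open import Data.List.Membership.Propositional.Properties
  using (∈-map⁺; ∈-map⁻; ∈-filter⁺; ∈-filter⁻; ∈-++⁺ˡ; ∈-++⁺ʳ; ∈-++⁻; ∈-∃++; ∈-insert; ∈-concatMap⁺)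
open import Function using (_on_; _∘_; id)
open import Function.Bundles using (_⇔_; mk⇔)
open import Relation.Binary using (Rel; _⇒_)
import Relation.Binary as B
open import Relation.Binary.Definitions using (DecidableEquality)
open import Relation.Binary.Construct.Union using (_∪_)
open import Relation.Binary.Construct.Intersection using (_∩_)
open import Relation.Binary.Construct.Closure.ReflexiveTransitive using (Star; ε; _◅_)
open import Relation.Binary.PropositionalEquality
  using (_≡_; _≢_; refl; sym; trans; cong; subst; subst₂; module ≡-Reasoning)
open import Relation.Nullary using (yes; no; ¬_; contradiction)
open import Relation.Nullary.Decidable using (map′; _×-dec_; _⊎-dec_)
import Relation.Nullary.Decidable as Dec
open import Relation.Unary using (Pred)
import Relation.Unary as U

⌞_⌟ : {X : Set} → Pred X 0ℓ → Rel X 0ℓ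
⌞ a ⌟ y _ = a y

-- Inductive almost-full relations (Vytiniotis, Coquand and Wahlstedt): classically,
-- every infinite sequence x has x i R x j for some i < j.
data AlmostFull {X : Set} (R : Rel X 0ℓ) : Set₁ where
  now   : (∀ x y → R x y) → AlmostFull R
  later : (∀ x → AlmostFull (R ∪ ⌞ R x ⌟)) → AlmostFull R

module _ {X : Set} where

  AlmostFull-mono : {R S : Rel X 0ℓ} → R ⇒ S → AlmostFull R → AlmostFull S
  AlmostFull-mono R⇒S (now full) = now λ x y → R⇒S (full x y)
  AlmostFull-mono R⇒S (later W)  = later λ x → AlmostFull-mono (Sum.map R⇒S R⇒S) (W x)

  AlmostFull-on : {Y : Set} {R : Rel Y 0ℓ} (f : X → Y) → AlmostFull R → AlmostFull (R on f)
  AlmostFull-on f (now full) = now λ x y → full (f x) (f y)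
  AlmostFull-on f (later W)  = later λ x → AlmostFull-on f (W (f x))

  -- The unary case of the intersection theorem; A is kept general because it grows
  -- along the induction.
  ∩-unary-almostFull :
    {A R₁ R₂ : Rel X 0ℓ} {a b : Pred X 0ℓ} → U.Decidable a → U.Decidable b →
    AlmostFull R₁ → AlmostFull R₂ → R₁ ⇒ A ∪ ⌞ a ⌟ → R₂ ⇒ A ∪ ⌞ b ⌟ →
    AlmostFull (A ∪ ⌞ a U.∩ b ⌟)
  ∩-unary-almostFull-later :
    {A R₁ R₂ : Rel X 0ℓ} {a b : Pred X 0ℓ} → U.Decidable a → U.Decidable b →
    AlmostFull R₁ → AlmostFull R₂ → R₁ ⇒ A ∪ ⌞ a ⌟ → R₂ ⇒ A ∪ ⌞ b ⌟ →
    ∀ x → ¬ a x → AlmostFull ((A ∪ ⌞ a U.∩ b ⌟) ∪ ⌞ (A ∪ ⌞ a U.∩ b ⌟) x ⌟)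

  ∩-unary-almostFull {A} {a = a} {b} a? b? W₁ W₂ h₁ h₂ = later λ x → cases x (a? x) (b? x)
    where
    cases : ∀ x → Dec (a x) → Dec (b x) →
            AlmostFull ((A ∪ ⌞ a U.∩ b ⌟) ∪ ⌞ (A ∪ ⌞ a U.∩ b ⌟) x ⌟)
    cases x (yes ax) (yes bx) = now λ _ _ → inj₂ (inj₂ (ax , bx))
    cases x (no ¬ax) _        = ∩-unary-almostFull-later a? b? W₁ W₂ h₁ h₂ x ¬ax
    cases x (yes _)  (no ¬bx) =
      AlmostFull-mono (Sum.map (Sum.map₂ swap) (Sum.map₂ swap))
        (∩-unary-almostFull-later b? a? W₂ W₁ h₂ h₁ x ¬bx)

  ∩-unary-almostFull-later {A} {a = a} a? b? (now full) W₂ h₁ h₂ x ¬ax =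
    now λ y _ → inj₂ (inj₁ (fromInj₁ (⊥-elim ∘ ¬ax) (h₁ (full x y))))
  ∩-unary-almostFull-later {A} {R₁} {a = a} {b} a? b? (later W₁) W₂ h₁ h₂ x ¬ax =
    AlmostFull-mono reassoc (∩-unary-almostFull a? b? (W₁ x) W₂ h₁′ (Sum.map₁ inj₁ ∘ h₂))
    where
    h₁′ : R₁ ∪ ⌞ R₁ x ⌟ ⇒ (A ∪ ⌞ A x ⌟) ∪ ⌞ a ⌟
    h₁′ (inj₁ r) = Sum.map₁ inj₁ (h₁ r)
    h₁′ (inj₂ r) = inj₁ (inj₂ (fromInj₁ (⊥-elim ∘ ¬ax) (h₁ r)))
    reassoc : (A ∪ ⌞ A x ⌟) ∪ ⌞ a U.∩ b ⌟ ⇒ (A ∪ ⌞ a U.∩ b ⌟) ∪ ⌞ (A ∪ ⌞ a U.∩ b ⌟) x ⌟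
    reassoc (inj₁ (inj₁ p)) = inj₁ (inj₁ p)
    reassoc (inj₁ (inj₂ p)) = inj₂ (inj₁ p)
    reassoc (inj₂ p)        = inj₁ (inj₂ p)

  ∩-almostFull : {R S : Rel X 0ℓ} → B.Decidable R → B.Decidable S →
                 AlmostFull R → AlmostFull S → AlmostFull (R ∩ S)
  ∩-almostFull R? S? (now full) W = AlmostFull-mono (full _ _ ,_) W
  ∩-almostFull R? S? W (now full) = AlmostFull-mono (_, full _ _) W
  ∩-almostFull {R} {S} R? S? (later WR) (later WS) = later λ x →
    ∩-unary-almostFull (R? x) (S? x)
      (∩-almostFull (λ y z → R? y z ⊎-dec R? x y) S? (WR x) (later WS))
      (∩-almostFull R? (λ y z → S? y z ⊎-dec S? x y) (later WR) (WS x))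
      (λ { (r , s) → Sum.map (_, s) id r })
      (λ { (r , s) → Sum.map (r ,_) id s })

≤-∪-≥-almostFull : ∀ k → AlmostFull {ℕ} (_≤_ ∪ ⌞ k ≤_ ⌟)
≤-∪-≥-almostFull zero    = now λ _ _ → inj₂ z≤n
≤-∪-≥-almostFull (suc k) = later λ w → step w (suc k ≤? w)
  where
  step : ∀ w → Dec (suc k ≤ w) →
         AlmostFull ((_≤_ ∪ ⌞ suc k ≤_ ⌟) ∪ ⌞ (_≤_ ∪ ⌞ suc k ≤_ ⌟) w ⌟)
  step w (yes k<w) = now λ _ _ → inj₂ (inj₂ k<w)
  step w (no k≮w)  = AlmostFull-mono
    Sum.[ inj₁ ∘ inj₁ , (λ k≤y → inj₂ (inj₁ (≤-trans (≤-pred (≰⇒> k≮w)) k≤y))) ]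
    (≤-∪-≥-almostFull k)

≤-almostFull : AlmostFull _≤_
≤-almostFull = later ≤-∪-≥-almostFull

pointwise-≤-almostFull : {A : Set} (as : List A) →
                         AlmostFull {A → ℕ} (λ u v → All (λ a → u a ≤ v a) as)
pointwise-≤-almostFull [] = now λ _ _ → []
pointwise-≤-almostFull (a ∷ as) =
  AlmostFull-mono (λ (le , les) → le ∷ les)
    (∩-almostFull (λ u v → u a ≤? v a) (λ u v → all? (λ b → u b ≤? v b) as)
      (AlmostFull-on (λ u → u a) ≤-almostFull) (pointwise-≤-almostFull as))

≡-almostFull : ∀ {n} → AlmostFull {Fin n} _≡_
≡-almostFull {n} = AlmostFull-mono ≤-and-∸≤⇒≡
  (∩-almostFull (λ i j → toℕ i ≤? toℕ j) (λ i j → n ∸ toℕ i ≤? n ∸ toℕ j)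
    (AlmostFull-on toℕ ≤-almostFull) (AlmostFull-on (λ i → n ∸ toℕ i) ≤-almostFull))
  where
  ≤-and-∸≤⇒≡ : ∀ {i j : Fin n} → toℕ i ≤ toℕ j × n ∸ toℕ i ≤ n ∸ toℕ j → i ≡ j
  ≤-and-∸≤⇒≡ {i} {j} (i≤j , n-i≤n-j) = toℕ-injective
    (∸-cancelˡ-≡ (toℕ≤n i) (toℕ≤n j) (≤-antisym n-i≤n-j (∸-monoʳ-≤ n i≤j)))

module Multiplicity {A : Set} (_≟_ : DecidableEquality A) where

  infixl 6 _∖_

  δ : A → A → ℕ
  δ x y with x ≟ y
  ... | yes _ = 1
  ... | no  _ = 0

  δ-refl : ∀ x → δ x x ≡ 1
  δ-refl x with x ≟ x
  ... | yes _  = refl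
  ... | no x≢x = contradiction refl x≢x

  δ-≢ : ∀ {x y} → x ≢ y → δ x y ≡ 0
  δ-≢ {x} {y} x≢y with x ≟ y
  ... | yes x≡y = contradiction x≡y x≢y
  ... | no  _   = refl

  count : A → List A → ℕ
  count x []       = 0
  count x (y ∷ ys) = δ x y + count x ys

  count-++ : ∀ x xs ys → count x (xs ++ ys) ≡ count x xs + count x ys
  count-++ x []       ys = refl
  count-++ x (y ∷ xs) ys rewrite count-++ x xs ys = sym (+-assoc (δ x y) _ _)

  count-middle : ∀ x y xs ys → count x (xs ++ y ∷ ys) ≡ δ x y + count x (xs ++ ys)
  count-middle x y xs ys = begin
    count x (xs ++ y ∷ ys)              ≡⟨ count-++ x xs (y ∷ ys) ⟩
    count x xs + (δ x y + count x ys)   ≡⟨ x∙yz≈y∙xz (count x xs) (δ x y) (count x ys) ⟩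
    δ x y + (count x xs + count x ys)   ≡⟨ cong (δ x y +_) (sym (count-++ x xs ys)) ⟩
    δ x y + count x (xs ++ ys)          ∎
    where open ≡-Reasoning

  count>0⇒∈ : ∀ {x xs} → 0 < count x xs → x ∈ xs
  count>0⇒∈ {x} {y ∷ ys} pos with x ≟ y
  ... | yes x≡y = here x≡y
  ... | no  _   = there (count>0⇒∈ pos)

  ∈⇒count>0 : ∀ {x xs} → x ∈ xs → 0 < count x xs
  ∈⇒count>0 {x} (here refl) rewrite δ-refl x = s≤s z≤n
  ∈⇒count>0 {x} {y ∷ _} (there x∈xs) = <-≤-trans (∈⇒count>0 x∈xs) (m≤n+m _ (δ x y))

  remove : A → List A → List A
  remove x []       = []
  remove x (y ∷ ys) with x ≟ y
  ... | yes _ = ys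
  ... | no  _ = y ∷ remove x ys

  count-remove : ∀ z x ys → count z (remove x ys) ≡ count z ys ∸ δ z x
  count-remove z x []       = sym (0∸n≡0 (δ z x))
  count-remove z x (y ∷ ys) with x ≟ y
  ... | yes refl = sym (m+n∸m≡n (δ z x) (count z ys))
  ... | no  x≢y with z ≟ x
  ...   | yes refl rewrite δ-≢ x≢y | count-remove x x ys | δ-refl x = refl
  ...   | no  z≢x  rewrite count-remove z x ys | δ-≢ z≢x = refl

  _∖_ : List A → List A → List A
  xs ∖ []       = xs
  xs ∖ (y ∷ ys) = remove y xs ∖ ys

  count-∖ : ∀ z xs ys → count z (xs ∖ ys) ≡ count z xs ∸ count z ys
  count-∖ z xs []       = refl
  count-∖ z xs (y ∷ ys) = begin
    count z (remove y xs ∖ ys)          ≡⟨ count-∖ z (remove y xs) ys ⟩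
    count z (remove y xs) ∸ count z ys  ≡⟨ cong (_∸ count z ys) (count-remove z y xs) ⟩
    count z xs ∸ δ z y ∸ count z ys     ≡⟨ ∸-+-assoc (count z xs) (δ z y) (count z ys) ⟩
    count z xs ∸ (δ z y + count z ys)   ∎
    where open ≡-Reasoning

infix 4 _≟ᵉ_

_≟ᵉ_ : ∀ {n} → DecidableEquality (Event n)
e ≟ᵉ e′ = map′ (cong fromTuple) (cong toTuple)
  (≡-dec ℕ._≟_ (≡-dec ℕ._≟_ (≡-dec Fin._≟_ Fin._≟_)) (toTuple e) (toTuple e′))
  where
  toTuple : ∀ {n} → Event n → ℕ × ℕ × Fin n × Fin n
  toTuple (ev t l a b) = t , l , a , b
  fromTuple : ∀ {n} → ℕ × ℕ × Fin n × Fin n → Event n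
  fromTuple (t , l , a , b) = ev t l a b

module Abstract {n : ℕ} (C : Contract n) where

  open Multiplicity (_≟ᵉ_ {n})

  -- A marking (q , Ψ) stands for the configuration C(q, _, Ψ). A step fuses a Function or
  -- Event-Match step with the State-Change after it; reset is Tick-Plus for pending events
  -- of time 0, the only ones that occur in DI contracts.
  Marking : Set
  Marking = Fin n × Pending n

  infix 4 _↝_ _≼_ _⊑_

  data _↝_ : Marking → Marking → Set where
    fire  : ∀ {f Ψ} → f ∈ functions C → (src f , Ψ) ↝ (tgt f , events f ++ Ψ)
    match : ∀ {e Ψ₁ Ψ₂} → e ∈ allEvents C → (from e , Ψ₁ ++ e ∷ Ψ₂) ↝ (to e , Ψ₁ ++ Ψ₂)
    reset : ∀ {q Ψ} → ¬ InitEv C q → (q , Ψ) ↝ (q , [])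

  -- Only events of C are counted, which keeps ⊑ decidable and almost full; the pending
  -- events of all markings that matter are events of C.
  record _≼_ (Ψ Ψ′ : Pending n) : Set where
    constructor counts≤
    field on-events : All (λ e → count e Ψ ≤ count e Ψ′) (allEvents C)

  _⊑_ : Marking → Marking → Set
  (q , Ψ) ⊑ (q′ , Ψ′) = q ≡ q′ × Ψ ≼ Ψ′

  []≼ : ∀ Ψ → [] ≼ Ψ
  []≼ Ψ = counts≤ (All.tabulate λ _ → z≤n)

  ≼-trans : ∀ {Ψ Ψ′ Ψ″} → Ψ ≼ Ψ′ → Ψ′ ≼ Ψ″ → Ψ ≼ Ψ″
  ≼-trans (counts≤ p) (counts≤ q) =
    counts≤ (All.zipWith (λ (le , le′) → ≤-trans le le′) (p , q))

  ⊑-trans : ∀ {c d e} → c ⊑ d → d ⊑ e → c ⊑ e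
  ⊑-trans (refl , p) (refl , q) = refl , ≼-trans p q

  _≼?_ : ∀ Ψ Ψ′ → Dec (Ψ ≼ Ψ′)
  Ψ ≼? Ψ′ =
    map′ counts≤ _≼_.on-events (all? (λ e → count e Ψ ≤? count e Ψ′) (allEvents C))

  ≼-almostFull : AlmostFull _≼_
  ≼-almostFull = AlmostFull-mono counts≤
    (AlmostFull-on (λ Ψ e → count e Ψ) (pointwise-≤-almostFull (allEvents C)))

  _⊑?_ : ∀ c d → Dec (c ⊑ d)
  (q , Ψ) ⊑? (q′ , Ψ′) = q Fin.≟ q′ ×-dec Ψ ≼? Ψ′

  ⊑-almostFull : AlmostFull _⊑_
  ⊑-almostFull = ∩-almostFull (λ c d → proj₁ c Fin.≟ proj₁ d) (λ c d → proj₂ c ≼? proj₂ d)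
    (AlmostFull-on proj₁ ≡-almostFull) (AlmostFull-on proj₂ ≼-almostFull)

  ≼-++⁺ˡ : ∀ W {Ψ Ψ′} → Ψ ≼ Ψ′ → W ++ Ψ ≼ W ++ Ψ′
  ≼-++⁺ˡ W {Ψ} {Ψ′} (counts≤ le) = counts≤ (All.map (λ {e} → monotone e) le)
    where
    open ℕ.≤-Reasoning
    monotone : ∀ e → count e Ψ ≤ count e Ψ′ → count e (W ++ Ψ) ≤ count e (W ++ Ψ′)
    monotone e le = begin
      count e (W ++ Ψ)        ≡⟨ count-++ e W Ψ ⟩
      count e W + count e Ψ   ≤⟨ +-monoʳ-≤ (count e W) le ⟩
      count e W + count e Ψ′  ≡⟨ count-++ e W Ψ′ ⟨
      count e (W ++ Ψ′)       ∎

  ≼-middle⁻ : ∀ {e} Ψ₁ Ψ₂ Ψ₃ Ψ₄ → Ψ₁ ++ e ∷ Ψ₂ ≼ Ψ₃ ++ e ∷ Ψ₄ → Ψ₁ ++ Ψ₂ ≼ Ψ₃ ++ Ψ₄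
  ≼-middle⁻ {e} Ψ₁ Ψ₂ Ψ₃ Ψ₄ (counts≤ le) = counts≤ (All.map (λ {x} le →
    +-cancelˡ-≤ (δ x e) _ _
      (subst₂ _≤_ (count-middle x e Ψ₁ Ψ₂) (count-middle x e Ψ₃ Ψ₄) le)) le)

  ≼-middle⁺ : ∀ {e} Ψ₁ Ψ₂ Ψ₃ Ψ₄ → Ψ₁ ++ Ψ₂ ≼ Ψ₃ ++ Ψ₄ → Ψ₁ ++ e ∷ Ψ₂ ≼ Ψ₃ ++ e ∷ Ψ₄
  ≼-middle⁺ {e} Ψ₁ Ψ₂ Ψ₃ Ψ₄ (counts≤ le) = counts≤ (All.map (λ {x} le →
    subst₂ _≤_ (sym (count-middle x e Ψ₁ Ψ₂)) (sym (count-middle x e Ψ₃ Ψ₄))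
      (+-monoʳ-≤ (δ x e) le)) le)

  ∈-≼ : ∀ {e Ψ Ψ′} → e ∈ allEvents C → e ∈ Ψ → Ψ ≼ Ψ′ → e ∈ Ψ′
  ∈-≼ e∈C e∈Ψ (counts≤ le) = count>0⇒∈ (<-≤-trans (∈⇒count>0 e∈Ψ) (All.lookup le e∈C))

  ↝-monotone : ∀ {c c′ d} → c ⊑ d → c ↝ c′ → ∃[ d′ ] d ↝ d′ × c′ ⊑ d′
  ↝-monotone (refl , le) (fire {f} f∈) = _ , fire f∈ , refl , ≼-++⁺ˡ (events f) le
  ↝-monotone (refl , le) (match {Ψ₁ = Ψ₁} {Ψ₂} e∈) with ∈-∃++ (∈-≼ e∈ (∈-insert Ψ₁) le)
  ... | Ψ₃ , Ψ₄ , refl = _ , match e∈ , refl , ≼-middle⁻ Ψ₁ Ψ₂ Ψ₃ Ψ₄ le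
  ↝-monotone (refl , _) (reset ¬init) = _ , reset ¬init , refl , []≼ []

  ≼-++-∖ : ∀ W Ψ → Ψ ≼ W ++ (Ψ ∖ W)
  ≼-++-∖ W Ψ = counts≤ (All.tabulate λ {x} _ →
    subst (count x Ψ ≤_)
      (sym (trans (count-++ x W (Ψ ∖ W)) (cong (count x W +_) (count-∖ x Ψ W))))
      (m≤n+m∸n (count x Ψ) (count x W)))

  ∖-≼ : ∀ W {Ψ Ψ′} → Ψ ≼ W ++ Ψ′ → Ψ ∖ W ≼ Ψ′
  ∖-≼ W {Ψ} {Ψ′} (counts≤ le) = counts≤ (All.map (λ {x} le →
    subst (_≤ count x Ψ′) (sym (count-∖ x Ψ W))
      (m≤n+o⇒m∸n≤o (count x Ψ) (count x W)
        (subst (count x Ψ ≤_) (count-++ x W Ψ′) le))) le)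

  ↝*-monotone : ∀ {c d c′} → c ⊑ d → Star _↝_ c c′ → ∃[ d′ ] Star _↝_ d d′ × c′ ⊑ d′
  ↝*-monotone c⊑d ε = _ , ε , c⊑d
  ↝*-monotone c⊑d (step ◅ steps) with ↝-monotone c⊑d step
  ... | d′ , step′ , c′⊑d′ with ↝*-monotone c′⊑d′ steps
  ...   | d″ , steps′ , c″⊑d″ = d″ , step′ ◅ steps′ , c″⊑d″

  fire-predecessor : Marking → Function n → Marking
  fire-predecessor (_ , Ψ) f = src f , Ψ ∖ events f

  match-predecessor : Marking → Event n → Marking
  match-predecessor (_ , Ψ) e = from e , e ∷ Ψ

  predecessors : Marking → List Marking
  predecessors b@(q , _) =
    map (fire-predecessor b) (filter (λ f → tgt f Fin.≟ q) (functions C)) ++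
    map (match-predecessor b) (filter (λ e → to e Fin.≟ q) (allEvents C))

  predecessor-sound : ∀ {p b} → p ∈ predecessors b → ∃[ b′ ] p ↝ b′ × b ⊑ b′
  predecessor-sound {b = b@(q , Ψ)} p∈ with ∈-++⁻ (map (fire-predecessor b) _) p∈
  ... | inj₁ p∈fire with ∈-map⁻ (fire-predecessor b) p∈fire
  ...   | f , f∈ , refl with ∈-filter⁻ (λ f → tgt f Fin.≟ q) f∈
  ...     | f∈C , refl = _ , fire f∈C , refl , ≼-++-∖ (events f) Ψ
  predecessor-sound {b = b@(q , Ψ)} p∈ | inj₂ p∈match with ∈-map⁻ (match-predecessor b) p∈match
  ...   | e , e∈ , refl with ∈-filter⁻ (λ e → to e Fin.≟ q) e∈
  ...     | e∈C , refl = _ , match {Ψ₁ = []} e∈C , refl , counts≤ (All.tabulate λ _ → ≤-refl)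

  predecessor-complete : ∀ {b c c′} → c ↝ c′ → b ⊑ c′ → b ⊑ c ⊎ Any (_⊑ c) (predecessors b)
  predecessor-complete {b = b@(q , _)} (fire {f} f∈) (refl , le) =
    inj₂ (lose (∈-++⁺ˡ (∈-map⁺ (fire-predecessor b) (∈-filter⁺ (λ f → tgt f Fin.≟ q) f∈ refl)))
               (refl , ∖-≼ (events f) le))
  predecessor-complete {b = b@(q , Ψ)} (match {e} {Ψ₁} {Ψ₂} e∈) (refl , le) =
    inj₂ (lose (∈-++⁺ʳ (map (fire-predecessor b) _)
                 (∈-map⁺ (match-predecessor b) (∈-filter⁺ (λ e → to e Fin.≟ q) e∈ refl)))
               (refl , ≼-middle⁺ [] Ψ Ψ₁ Ψ₂ le))
  predecessor-complete {c = _ , Ψ} (reset _) b⊑c′ = inj₁ (⊑-trans b⊑c′ (refl , []≼ Ψ))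

  module Coverability (Q : Fin n) where

    Reaches : Marking → Set
    Reaches c = ∃[ Ψ ] Star _↝_ c (Q , Ψ)

    reaches-upward : ∀ {c d} → c ⊑ d → Reaches c → Reaches d
    reaches-upward c⊑d (_ , steps) with ↝*-monotone c⊑d steps
    ... | _ , steps′ , (refl , _) = _ , steps′

    Covered : List Marking → Marking → Set
    Covered B c = Any (_⊑ c) B

    covered? : ∀ B c → Dec (Covered B c)
    covered? B c = any? (_⊑? c) B

    covered-upward : ∀ {B c d} → Covered B c → c ⊑ d → Covered B d
    covered-upward cov c⊑d = Any.map (λ b⊑c → ⊑-trans b⊑c c⊑d) cov

    covered⇒reaches : ∀ {B c} → All Reaches B → Covered B c → Reaches c
    covered⇒reaches sound cov with find cov
    ... | b , b∈B , b⊑c = reaches-upward b⊑c (All.lookup sound b∈B)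

    Closed : List Marking → Set
    Closed B = All (λ b → All (Covered B) (predecessors b)) B

    closed? : ∀ B → Dec (Closed B)
    closed? B = all? (λ b → all? (covered? B) (predecessors b)) B

    uncovered-predecessor : ∀ {B} → ¬ Closed B →
                            ∃[ b ] b ∈ B × ∃[ p ] p ∈ predecessors b × ¬ Covered B p
    uncovered-predecessor {B} ¬closed
      with find (¬All⇒Any¬ (λ b → all? (covered? B) (predecessors b)) B ¬closed)
    ... | b , b∈B , ¬all with find (¬All⇒Any¬ (covered? B) (predecessors b) ¬all)
    ...   | p , p∈ , p∉ = b , b∈B , p , p∈ , p∉

    closed-complete : ∀ {B c Ψ} → Closed B → Covered B (Q , []) → Star _↝_ c (Q , Ψ) → Covered B c
    closed-complete {Ψ = Ψ} _ target ε = covered-upward target (refl , []≼ Ψ)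
    closed-complete closed target (step ◅ steps) with find (closed-complete closed target steps)
    ... | b , b∈B , b⊑c′ with predecessor-complete step b⊑c′
    ...   | inj₁ b⊑c = lose b∈B b⊑c
    ...   | inj₂ p⊑c with find p⊑c
    ...     | p , p∈ , p⊑c″ = covered-upward (All.lookup (All.lookup closed b∈B) p∈) p⊑c″

    record Basis : Set where
      field
        elements : List Marking
        sound    : All Reaches elements
        target   : Covered elements (Q , [])
        closed   : Closed elements

    -- Invariant of saturation: S-related pairs are ordered unless the left one is covered.
    -- Every added p is uncovered, so S can be refined to S ∪ ⌞ S p ⌟, and the almost-fullness
    -- of S bounds the number of additions.
    Settled : List Marking → Rel Marking 0ℓ
    Settled B c d = c ⊑ d ⊎ Covered B c

    saturate : ∀ {S} B → All Reaches B → Covered B (Q , []) → AlmostFull S → S ⇒ Settled B → Basis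
    saturate B sound target _ _ with closed? B
    ... | yes closed = record { elements = B ; sound = sound ; target = target ; closed = closed }
    saturate B sound target W S⇒ | no ¬closed with uncovered-predecessor ¬closed
    ... | b , b∈B , p , p∈ , p∉ = extend W S⇒
      where
      p-reaches : Reaches p
      p-reaches with predecessor-sound p∈
      ... | b′ , step , b⊑b′ =
        Product.map₂ (step ◅_) (reaches-upward b⊑b′ (All.lookup sound b∈B))

      p⊑ : ∀ {c} → Settled B p c → p ⊑ c
      p⊑ = fromInj₁ (⊥-elim ∘ p∉)

      extend : ∀ {S} → AlmostFull S → S ⇒ Settled B → Basis
      -- S is full, so p lies below every marking.
      extend (now full) S⇒ = record
        { elements = p ∷ B ; sound = p-reaches ∷ sound ; target = there target
        ; closed = All.tabulate λ _ → All.tabulate λ {d} _ → here (p⊑ (S⇒ (full p d))) }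
      extend {S} (later W) S⇒ = saturate (p ∷ B) (p-reaches ∷ sound) (there target) (W p) S⇒′
        where
        S⇒′ : S ∪ ⌞ S p ⌟ ⇒ Settled (p ∷ B)
        S⇒′ (inj₁ s) = Sum.map₂ there (S⇒ s)
        S⇒′ (inj₂ s) = inj₂ (here (p⊑ (S⇒ s)))

    basis : Basis
    basis = saturate [ Q , [] ] ((_ , ε) ∷ []) (here (refl , []≼ [])) ⊑-almostFull inj₁

    reaches? : ∀ c → Dec (Reaches c)
    reaches? c = map′ (covered⇒reaches sound) (λ (_ , steps) → closed-complete closed target steps)
                      (covered? elements c)
      where open Basis basis

module Concrete {n : ℕ} (C : Contract n) (di : IsDI C) where

  open Abstract C

  InContract : Pending n → Set
  InContract = All (_∈ allEvents C)

  events-inContract : ∀ {f} → f ∈ functions C → InContract (events f)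
  events-inContract f∈ = All.tabulate λ e∈ → ∈-concatMap⁺ events (Any.map (λ { refl → e∈ }) f∈)

  tick-inContract : ∀ {Ψ} → InContract Ψ → tick Ψ ≡ []
  tick-inContract [] = refl
  tick-inContract {ev _ _ _ _ ∷ _} (e∈ ∷ Ψ∈C)
    rewrite All.lookup (proj₁ di) e∈ = tick-inContract Ψ∈C

  nored-inContract : ∀ {f Ψ} → f ∈ functions C → InContract Ψ → nored Ψ (src f)
  nored-inContract f∈ Ψ∈C pending with find pending
  ... | e , e∈Ψ , _ , from≡src =
    proj₂ di _ (lose f∈ refl) (lose (All.lookup Ψ∈C e∈Ψ) from≡src)

  inContract-middle⁻ : ∀ {e} Ψ₁ {Ψ₂} → InContract (Ψ₁ ++ e ∷ Ψ₂) →
                       e ∈ allEvents C × InContract (Ψ₁ ++ Ψ₂)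
  inContract-middle⁻ Ψ₁ inC with ++⁻ Ψ₁ inC
  ... | g₁ , e∈ ∷ g₂ = e∈ , ++⁺ g₁ g₂

  idle : Marking → Config n
  idle (q , Ψ) = cfg q nothing Ψ

  marking : Config n → Marking
  marking (cfg q nothing Ψ) = q , Ψ
  marking (cfg _ (just (Ψ′ , q′)) Ψ) = q′ , Ψ′ ++ Ψ

  tick-plus-inContract : ∀ {q Ψ} → InContract Ψ → ¬ InitEv C q →
                         Step C (cfg q nothing Ψ) (cfg q nothing [])
  tick-plus-inContract {q} {Ψ} inC ¬init =
    subst (Step C (cfg q nothing Ψ) ∘ cfg q nothing) (tick-inContract inC) (tick-plus ¬init)

  ↝*⇒⟶* : ∀ {c c′} → InContract (proj₂ c) → Star _↝_ c c′ → Star (Step C) (idle c) (idle c′)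
  ↝*⇒⟶* _ ε = ε
  ↝*⇒⟶* inC (fire f∈ ◅ steps) =
    function f∈ (nored-inContract f∈ inC) ◅ state-change ◅
    ↝*⇒⟶* (++⁺ (events-inContract f∈) inC) steps
  ↝*⇒⟶* inC (match {Ψ₁ = Ψ₁} e∈ ◅ steps) =
    event-match {Ψ₁ = Ψ₁} (All.lookup (proj₁ di) e∈) ◅ state-change ◅
    ↝*⇒⟶* (proj₂ (inContract-middle⁻ Ψ₁ inC)) steps
  ↝*⇒⟶* inC (reset ¬init ◅ steps) = tick-plus-inContract inC ¬init ◅ ↝*⇒⟶* [] steps

  ⟶*⇒↝* : ∀ {κ κ′} → InContract (proj₂ (marking κ)) → Star (Step C) κ κ′ →
          Star _↝_ (marking κ) (marking κ′)
  ⟶*⇒↝* _ ε = ε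
  ⟶*⇒↝* inC (function f∈ _ ◅ steps) = fire f∈ ◅ ⟶*⇒↝* (++⁺ (events-inContract f∈) inC) steps
  ⟶*⇒↝* inC (state-change ◅ steps) = ⟶*⇒↝* inC steps
  ⟶*⇒↝* inC (event-match {Ψ₁ = Ψ₁} refl ◅ steps) with inContract-middle⁻ Ψ₁ inC
  ... | e∈ , inC′ = match e∈ ◅ ⟶*⇒↝* inC′ steps
  ⟶*⇒↝* {cfg q nothing Ψ} inC (tick-plus ¬init ◅ steps) with tick Ψ | tick-inContract inC
  ... | _ | refl = reset ¬init ◅ ⟶*⇒↝* [] steps

  reaches⇔stateReachable : ∀ Q → Coverability.Reaches Q (init C , []) ⇔ StateReachable C Q
  reaches⇔stateReachable Q =
    mk⇔ (λ (Ψ , steps) → Ψ , ↝*⇒⟶* [] steps) (λ (Ψ , steps) → Ψ , ⟶*⇒↝* [] steps)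

theorem1 : ∀ (n : ℕ) (C : Contract n) → WellFormed C → IsDI C →
    (Q : Fin n) → Dec (StateReachable C Q)
-- Line indices play no role in the semantics, so well-formedness is not needed.
theorem1 n C _ di Q = Dec.map (reaches⇔stateReachable Q) (reaches? (init C , []))
  where
  open Concrete C di
  open Abstract.Coverability C Q
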